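{- Let $A$ be a finite set of actions, $\varphi$ an LTL$_f$ formula over $A$, $\mathcal{A}_\varphi=(A,Q,q_0,F,\delta)$ an NFA with $\delta\subseteq Q\times A\times Q$ whose language is exactly the set of words $a_1\cdots a_m\in A^*$ with $a_1\cdots a_m\models\varphi$, and $\mathcal{C}=\{\mathcal{S}_1,\dots,\mathcal{S}_n\}$ a community of nondeterministic services. Let $\mathcal{A}_{\varphi,\mathcal{C}}$ be the composition automaton and $\tau_{\varphi,\mathcal{C}}$ the associated map from words to histories (both defined below). Then for every history $h$ of $\mathcal{C}$: $h$ is successful if and only if there exists a word $w\in A'^*$ with $w\in\mathcal{L}(\mathcal{A}_{\varphi,\mathcal{C}})$ and $h=\tau_{\varphi,\mathcal{C}}(w)$.
   Context: LTL$_f$ formulas over $A$ are evaluated on finite words $a_1\cdots a_m\in A^*$ (the "Declare assumption": exactly one action holds at each instant); we write $a_1\cdots a_m\models\varphi$. A (nondeterministic) service is a tuple $\mathcal{S}_i=\langle\Sigma_i,A_i,\sigma_{i0},F_i,\delta_i\rangle$ with $\Sigma_i$ a finite set of states, $A_i\subseteq A$ a set of actions, $\sigma_{i0}\in\Sigma_i$ the initial state, $F_i\subseteq\Sigma_i$ the final states, and $\delta_i\subseteq\Sigma_i\times A_i\times\Sigma_i$ a transition relation such that for every $\sigma\in\Sigma_i$ and $a\in A_i$ there is some $\sigma'$ with $(\sigma,a,\sigma')\in\delta_i$. A trace of the community $\mathcal{C}$ is an infinite alternating sequence $c_0,(a_1,o_1),c_1,(a_2,o_2),\dots$ where $c_k=(\sigma_{1k},\dots,\sigma_{nk})\in\Sigma_1\times\cdots\times\Sigma_n$,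 $c_0=(\sigma_{10},\dots,\sigma_{n0})$, $a_k\in A$, $o_k\in\{1,\dots,n\}$, and for all $k\ge0$ and all $i$: $(\sigma_{ik},a_{k+1},\sigma_{i,k+1})\in\delta_i$ if $o_{k+1}=i$, and $\sigma_{i,k+1}=\sigma_{ik}$ otherwise. A history is a finite prefix $c_0,(a_1,o_1),\dots,(a_m,o_m),c_m$ of a trace ending in a configuration; $\mathsf{actions}(h)=a_1\cdots a_m$. A history is successful if $\mathsf{actions}(h)\models\varphi$ and $\sigma_{im}\in F_i$ for all $i\in\{1,\dots,n\}$. The composition DFA $\mathcal{A}_{\varphi,\mathcal{C}}=(A',Q',q'_0,F',\delta')$ is: $A'=\{(a,q,i,\sigma): a\in A,\ q\in Q,\ i\in\{1,\dots,n\},\ \sigma\in\Sigma_i\}$; $Q'=Q\times\Sigma_1\times\cdots\times\Sigma_n$; $q'_0=(q_0,\sigma_{10},\dots,\sigma_{n0})$; $F'=F\times F_1\times\cdots\times F_n$; and $\delta'((q,\sigma_1,\dots,\sigma_i,\dots,\sigma_n),(a,q',i,\sigma'_i))=(q',\sigma_1,\dots,\sigma'_i,\dots,\sigma_n)$ if $(\sigma_i,a,\sigma'_i)\in\delta_i$ and $(q,a,q')\in\delta$, undefined otherwise. A word is accepted if its run is defined throughout and ends in $F'$. For a word $w=(a_1,q_1,o_1,\sigma^{(1)})\cdots(a_m,q_m,o_m,\sigma^{(m)})$ whose run is $(q_0,\sigma_{10},\dots,\sigma_{n0}),\dots,(q_m,\sigma_{1m},\dots,\sigma_{nm})$, define $\tau_{\varphi,\mathcal{C}}(w)=(\sigma_{10},\dots,\sigma_{n0}),(a_1,o_1),\dots,(a_m,o_m),(\sigma_{1m},\dots,\sigma_{nm})$.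 -}

module Defs where

open import Data.Nat using (ℕ; zero; suc; _<_)
open import Data.Fin using (Fin; _≟_)
open import Data.Bool using (Bool; true; false; _∧_; T; if_then_else_)
open import Data.List using (List; []; _∷_; length; drop)
open import Data.Maybe using (Maybe; just; nothing)
open import Data.Product using (Σ; _×_; _,_; ∃; ∃-syntax; proj₁; proj₂)
open import Data.Empty using (⊥)
open import Relation.Nullary using (¬_; yes; no)
open import Relation.Binary.PropositionalEquality using (_≡_; _≢_; refl)
open import Data.List.Relation.Binary.Pointwise using (Pointwise)

-- LTLf over A (Declare assumption: atoms are actions, one per instant)

data LTLf (nA : ℕ) : Set where
  tt    : LTLf nA
  act   : Fin nA → LTLf nA
  ¬ₗ_   : LTLf nA → LTLf nA
  _∧ₗ_  : LTLf nA → LTLf nA → LTLf nA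
  X     : LTLf nA → LTLf nA
  _U_   : LTLf nA → LTLf nA → LTLf nA

_⊨_ : {nA : ℕ} → List (Fin nA) → LTLf nA → Set
w ⊨ tt = Data.Unit.⊤ where import Data.Unit
[] ⊨ act a = ⊥
(x ∷ w) ⊨ act a = x ≡ a
w ⊨ (¬ₗ φ) = ¬ (w ⊨ φ)
w ⊨ (φ ∧ₗ ψ) = (w ⊨ φ) × (w ⊨ ψ)
[] ⊨ X φ = ⊥
(x ∷ w) ⊨ X φ = (0 < length w) × (w ⊨ φ)
w ⊨ (φ U ψ) = ∃[ k ] (k < length w) × (drop k w ⊨ ψ)
                 × (∀ j → j < k → drop j w ⊨ φ)

record NFA (nA : ℕ) : Set₁ where
  field
    nq    : ℕ
    q₀    : Fin nq
    final : Fin nq → Bool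
    δ     : Fin nq → Fin nA → Fin nq → Bool

module _ {nA : ℕ} (N : NFA nA) where
  open NFA N
  AcceptsFrom : Fin nq → List (Fin nA) → Set
  AcceptsFrom q [] = T (final q)
  AcceptsFrom q (a ∷ w) = ∃[ q' ] T (δ q a q') × AcceptsFrom q' w

  NFAAccepts : List (Fin nA) → Set
  NFAAccepts w = AcceptsFrom q₀ w

record Service (nA : ℕ) : Set where
  field
    nst     : ℕ
    inAct   : Fin nA → Bool
    σ₀      : Fin nst
    final   : Fin nst → Bool
    δ       : Fin nst → Fin nA → Fin nst → Bool
    δ-acts  : ∀ σ a σ' → T (δ σ a σ') → T (inAct a)
    δ-total : ∀ σ a → T (inAct a) → ∃[ σ' ] T (δ σ a σ')

Community : ℕ → ℕ → Set
Community nA n = Fin n → Service nA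

module Comm {nA n : ℕ} (C : Community nA n) where
  St : Fin n → Set
  St i = Fin (Service.nst (C i))

  Config : Set
  Config = (i : Fin n) → St i

  initConfig : Config
  initConfig i = Service.σ₀ (C i)

  -- configurations are compared pointwise (no funext in Agda)
  _≈C_ : Config → Config → Set
  c ≈C c' = ∀ i → c i ≡ c' i

  -- one step of a history: action a_k, chosen service o_k, new configuration c_k
  Step : Set
  Step = Fin nA × Fin n × Config

  record History : Set where
    constructor hist
    field
      start : Config
      steps : List Step

  actions : History → List (Fin nA)
  actions h = Data.List.map proj₁ (History.steps h)
    where import Data.List

  lastConfig : Config → List Step → Config
  lastConfig c [] = c
  lastConfig c ((_ , _ , c') ∷ s) = lastConfig c' s

  ValidFrom : Config → List Step → Set
  ValidFrom c [] = Data.Unit.⊤ where import Data.Unit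
  ValidFrom c ((a , o , c') ∷ s) =
    T (Service.δ (C o) (c o) a (c' o))
    × (∀ i → i ≢ o → c' i ≡ c i)
    × ValidFrom c' s

  IsHistory : History → Set
  IsHistory (hist c₀ s) = (c₀ ≈C initConfig) × ValidFrom c₀ s

  Successful : LTLf nA → History → Set
  Successful φ h = (actions h ⊨ φ)
    × (∀ i → T (Service.final (C i) (lastConfig (History.start h) (History.steps h) i)))

  StepEq : Step → Step → Set
  StepEq (a , o , c) (a' , o' , c') = (a ≡ a') × (o ≡ o') × (c ≈C c')

  _≈H_ : History → History → Set
  hist c s ≈H hist c' s' = (c ≈C c') × Pointwise StepEq s s'

  module Composition (N : NFA nA) where
    open NFA N renaming (δ to δN; final to finalN)

    A' : Set
    A' = Fin nA × Fin nq × Σ (Fin n) St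

    Q' : Set
    Q' = Fin nq × Config

    q'₀ : Q'
    q'₀ = (q₀ , initConfig)

    F' : Q' → Set
    F' (q , c) = T (finalN q) × (∀ i → T (Service.final (C i) (c i)))

    update : Config → (i : Fin n) → St i → Config
    update c i σ j with i ≟ j
    ... | yes refl = σ
    ... | no _ = c j

    δ' : Q' → A' → Maybe Q'
    δ' (q , c) (a , q' , i , σ') =
      if δN q a q' ∧ Service.δ (C i) (c i) a σ'
      then just (q' , update c i σ')
      else nothing

    -- the run of a word: the sequence of states after each letter (if defined)
    run : Q' → List A' → Maybe (List Q')
    run s [] = just []
    run s (x ∷ w) with δ' s x
    ... | nothing = nothing
    ... | just s' with run s' w
    ...   | nothing = nothing
    ...   | just r = just (s' ∷ r)

    lastQ : Q' → List Q' → Q'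
    lastQ s [] = s
    lastQ s (s' ∷ r) = lastQ s' r

    Accepts' : List A' → Set
    Accepts' w = ∃[ r ] (run q'₀ w ≡ just r) × F' (lastQ q'₀ r)

    buildSteps : List A' → List Q' → List Step
    buildSteps (( a , _ , o , _) ∷ w) ((_ , c) ∷ r) = (a , o , c) ∷ buildSteps w r
    buildSteps _ _ = []

    τ : List A' → Maybe History
    τ w with run q'₀ w
    ... | nothing = nothing
    ... | just r = just (hist initConfig (buildSteps w r))

    _≈τ_ : History → List A' → Set
    h ≈τ w = ∃[ h' ] (τ w ≡ just h') × (h ≈H h')

{-# OPTIONS --safe #-}
module Submission where

open import Defs
open import Data.Nat using (ℕ)
open import Data.Fin using (Fin; _≟_)
open import Data.List using (List; []; _∷_; map)
open import Data.Product using (_×_; ∃-syntax; _,_; proj₁)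
open import Data.Bool using (true; false; T)
open import Data.Bool.Properties using (T-≡)
open import Data.Maybe using (just; nothing)
open import Function.Bundles using (_⇔_; mk⇔; Equivalence)
open import Relation.Nullary using (yes; no)
open import Relation.Binary.PropositionalEquality using (_≡_; _≢_; refl; sym; trans; subst)
open import Data.List.Relation.Binary.Pointwise using (Pointwise; []; _∷_)

-- A letter (a, q', o, σ) of the composition guesses both the NFA successor q' and the new
-- state σ of the service o performing a, so δ' is exactly one NFA step in lockstep with one
-- community step.  Hence, by induction on the history, accepting runs of the composition are
-- the same as accepting NFA runs on the action word paired with valid histories ending in
-- final configurations, and τ reads the history back off the run.  Since configurations are
-- functions, the correspondence only holds up to pointwise equality _≈C_.

module CompositionCorrectness {nA n : ℕ} (C : Community nA n) (N : NFA nA) where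
  open Comm C
  open Composition N
  open NFA N using () renaming (δ to δN)

  AllFinal : Config → Set
  AllFinal c = ∀ i → T (Service.final (C i) (c i))

  AllFinal-resp-≈C : ∀ {c d} → c ≈C d → AllFinal c → AllFinal d
  AllFinal-resp-≈C c≈d fin i = subst (λ σ → T (Service.final (C i) σ)) (c≈d i) (fin i)

  update-≈C : ∀ (d c c' : Config) o → d ≈C c → (∀ i → i ≢ o → c' i ≡ c i)
            → update d o (c' o) ≈C c'
  update-≈C d c c' o d≈c frame j with o ≟ j
  ... | yes refl = refl
  ... | no o≢j = trans (d≈c j) (sym (frame j (λ j≡o → o≢j (sym j≡o))))

  δ'-step : ∀ q d a q' o σ → T (δN q a q') → T (Service.δ (C o) (d o) a σ)
          → δ' (q , d) (a , q' , o , σ) ≡ just (q' , update d o σ)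
  δ'-step q d a q' o σ tq tσ
    rewrite Equivalence.to T-≡ tq | Equivalence.to T-≡ tσ = refl

  δ'-step⁻ : ∀ q d a q' o σ s' → δ' (q , d) (a , q' , o , σ) ≡ just s'
           → T (δN q a q') × (s' ≡ (q' , update d o σ))
  δ'-step⁻ q d a q' o σ s' eq with δN q a q' | Service.δ (C o) (d o) a σ | eq
  ... | true  | true  | refl = _ , refl
  ... | true  | false | ()
  ... | false | _     | ()

  run-∷ : ∀ s x w s' r → δ' s x ≡ just s' → run s' w ≡ just r
        → run s (x ∷ w) ≡ just (s' ∷ r)
  run-∷ s x w s' r δ'≡ run≡ rewrite δ'≡ | run≡ = refl

  run-∷⁻ : ∀ s x w r → run s (x ∷ w) ≡ just r
         → ∃[ s' ] ∃[ r' ] (δ' s x ≡ just s') × (run s' w ≡ just r') × (r ≡ s' ∷ r')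
  run-∷⁻ s x w r eq with δ' s x | eq
  ... | nothing | ()
  ... | just s' | eq' with run s' w in run≡ | eq'
  ...   | nothing | ()
  ...   | just r' | refl = s' , r' , refl , run≡ , refl

  τ-run : ∀ w r → run q'₀ w ≡ just r → τ w ≡ just (hist initConfig (buildSteps w r))
  τ-run w r eq with run q'₀ w | eq
  ... | just _ | refl = refl

  steps⇒acceptingRun : ∀ q (d c : Config) s → d ≈C c → ValidFrom c s
    → AcceptsFrom N q (map proj₁ s) → AllFinal (lastConfig c s)
    → ∃[ w ] ∃[ r ] (run (q , d) w ≡ just r) × F' (lastQ (q , d) r)
                    × Pointwise StepEq s (buildSteps w r)
  steps⇒acceptingRun q d c [] d≈c _ final-q fin =
    [] , [] , refl , (final-q , AllFinal-resp-≈C (λ i → sym (d≈c i)) fin) , []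
  steps⇒acceptingRun q d c ((a , o , c') ∷ s) d≈c (tσ , frame , valid) (q' , tq , acc) fin
    with steps⇒acceptingRun q' (update d o (c' o)) c' s (update-≈C d c c' o d≈c frame) valid acc fin
  ... | w , r , run≡ , accepting , s≈ =
    (a , q' , o , c' o) ∷ w , (q' , update d o (c' o)) ∷ r ,
    run-∷ _ _ w _ r (δ'-step q d a q' o (c' o) tq tσ′) run≡ ,
    accepting ,
    (refl , refl , (λ i → sym (update-≈C d c c' o d≈c frame i))) ∷ s≈
    where tσ′ = subst (λ σ → T (Service.δ (C o) σ a (c' o))) (sym (d≈c o)) tσ

  acceptingRun⇒steps : ∀ q (d : Config) s w r → run (q , d) w ≡ just r
    → F' (lastQ (q , d) r) → Pointwise StepEq s (buildSteps w r) → (c : Config) → c ≈C d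
    → AcceptsFrom N q (map proj₁ s) × AllFinal (lastConfig c s)
  acceptingRun⇒steps q d [] [] .[] refl (final-q , fin) [] c c≈d =
    final-q , AllFinal-resp-≈C (λ i → sym (c≈d i)) fin
  acceptingRun⇒steps q d s (x ∷ w) r run≡ accepting s≈ c c≈d with run-∷⁻ _ x w r run≡
  acceptingRun⇒steps q d ((_ , _ , c') ∷ s) ((a , q' , o , σ) ∷ w) .(s' ∷ r') _ accepting
    ((refl , refl , c'≈) ∷ s≈) c c≈d | s' , r' , δ'≡ , run≡ , refl
    with δ'-step⁻ q d a q' o σ s' δ'≡
  ... | tq , refl with acceptingRun⇒steps q' (update d o σ) s w r' run≡ accepting s≈ c' c'≈
  ... | acc , fin = (q' , tq , acc) , fin

open CompositionCorrectness

proposition2 : (nA : ℕ) (φ : LTLf nA) (N : NFA nA)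
    → (∀ (w : List (Fin nA)) → NFAAccepts N w ⇔ (w ⊨ φ))
    → (n : ℕ) (C : Community nA n)
    → (h : Comm.History C) → Comm.IsHistory C h
    → Comm.Successful C φ h
      ⇔ (∃[ w ] Comm.Composition.Accepts' C N w × Comm.Composition._≈τ_ C N h w)
proposition2 nA φ N L≡φ n C (Comm.hist c₀ s) (c₀≈init , valid) = mk⇔ to from
  where
  to : Comm.Successful C φ (Comm.hist c₀ s)
     → ∃[ w ] Comm.Composition.Accepts' C N w × Comm.Composition._≈τ_ C N (Comm.hist c₀ s) w
  to (sat , fin)
    with steps⇒acceptingRun C N (NFA.q₀ N) (Comm.initConfig C) c₀ s (λ i → sym (c₀≈init i))
           valid (Equivalence.from (L≡φ _) sat) fin
  ... | w , r , run≡ , accepting , s≈ =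
    w , (r , run≡ , accepting) , (_ , τ-run C N w r run≡ , (c₀≈init , s≈))

  from : ∃[ w ] Comm.Composition.Accepts' C N w × Comm.Composition._≈τ_ C N (Comm.hist c₀ s) w
       → Comm.Successful C φ (Comm.hist c₀ s)
  from (w , (r , run≡ , accepting) , (h' , τ≡ , (c₀≈ , s≈)))
    with trans (sym (τ-run C N w r run≡)) τ≡
  ... | refl with acceptingRun⇒steps C N (NFA.q₀ N) (Comm.initConfig C) s w r run≡ accepting s≈ c₀ c₀≈
  ... | acc , fin = Equivalence.to (L≡φ _) acc , fin
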